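{- Let $\mathcal{L}$ be a finite-valued propositional logic with truth values $\mathcal{V}_\mathcal{L}$ and designated values $\mathcal{V}^+_\mathcal{L}$, and let $\mathcal{I}\subseteq\mathcal{V}_\mathcal{L}$. Let $\Gamma$ and $\Delta$ be $\mathcal{L}$-theories, and let $\mathit{Var}(\Gamma\cup\Delta)$ be the set of propositional constants occurring in formulas of $\Gamma$ or $\Delta$. Then $\Gamma \models^{\mathcal{I}}_\mathcal{L} \Delta$ holds if and only if the $\mathsf{ME}^{\mathcal{I}}_{\mathcal{L}}$-sequent $\emptyset ; \Gamma \Rightarrow^{\mathcal{I}}_{\mathcal{L}} \Delta ; \mathit{Var}(\Gamma \cup \Delta)$ is true.
   Context: A finite-valued propositional logic $\mathcal{L}$ has a finite set $\mathcal{V}_\mathcal{L}$ of truth values containing $\mathbf{t}$ and $\mathbf{f}$, a set $\mathcal{V}^+_\mathcal{L}\subset\mathcal{V}_\mathcal{L}$ of designated values with $\mathbf{t}\in\mathcal{V}^+_\mathcal{L}$, $\mathbf{f}\notin\mathcal{V}^+_\mathcal{L}$, a fixed countably infinite set $\mathcal{C}$ of propositional constants, and finitely many connectives, each $n$-ary connective $\circ$ interpreted by a truth function $f_\circ:\mathcal{V}_\mathcal{L}^n\to\mathcal{V}_\mathcal{L}$ (0-ary connectives are logical constants with a fixed value). Formulas are built from propositional constants and logical constants using the connectives. An interpretation is a map $I:\mathcal{C}\to\mathcal{V}_\mathcal{L}$, extended to a valuation $v^I_\mathcal{L}$ on all formulas compositionally via the truth functions. $I$ is a model of $\varphi$ if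 $v^I_\mathcal{L}(\varphi)\in\mathcal{V}^+_\mathcal{L}$; $I$ is a model of a theory (set of formulas) $\Gamma$ if it is a model of every element of $\Gamma$. For interpretations $I,J$ and $\Theta\subseteq\mathcal{C}$, write $I\le^{\mathcal{I},\Theta}_\mathcal{L}J$ iff $\{p\in\Theta\mid v^I_\mathcal{L}(p)\in\mathcal{I}\}\subseteq\{p\in\Theta\mid v^J_\mathcal{L}(p)\in\mathcal{I}\}$, and $I<^{\mathcal{I},\Theta}_\mathcal{L}J$ iff $I\le^{\mathcal{I},\Theta}_\mathcal{L}J$ but not $J\le^{\mathcal{I},\Theta}_\mathcal{L}I$. A model $I$ of $\Gamma$ is $(\mathcal{I};\Theta)$-minimal if there is no model $J$ of $\Gamma$ with $J<^{\mathcal{I},\Theta}_\mathcal{L}I$; it is $\mathcal{I}$-minimal if it is $(\mathcal{I};\mathcal{C})$-minimal. For theories $\Gamma,\Delta$: $\Gamma\models^{\mathcal{I}}_\mathcal{L}\Delta$ iff every $\mathcal{I}$-minimal model of $\Gamma$ is a model of some $\varphi\in\Delta$. An $\mathsf{ME}^{\mathcal{I}}_{\mathcal{L}}$-sequent is a quadruple $\Sigma;\Gamma\Rightarrow^{\mathcal{I}}_{\mathcal{L}}\Delta;\Theta$ with $\Sigma,\Theta\subseteq\mathcal{C}$ and $\Gamma,\Delta$ theories. It is true if for every interpretation $I$: whenever $I$ is a $(\mathcal{I};\Theta\cup\Sigma)$-minimal model of $\Gamma$ with $v^I_\mathcal{L}(p)\in\mathcal{I}$ for all $p\in\Sigma$,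 then $I$ is a model of some $\varphi\in\Delta$. -}

module Defs where

open import Data.Nat using (ℕ)
open import Data.Fin using (Fin)
open import Data.Fin.Subset using (Subset; _∈_; _∉_)
open import Data.Vec using (Vec; []; _∷_)
open import Data.Vec.Relation.Unary.Any using (Any)
open import Data.Product using (Σ; _×_; ∃-syntax)
open import Data.Sum using (_⊎_)
open import Data.Unit using (⊤)
open import Data.Empty using (⊥)
open import Relation.Nullary using (¬_; Dec)

-- Connectives: Fin nConn, connective c has arity (arity c) and truth function (fn c).
-- 0-ary connectives are the logical constants (their value is fn c []).
record Logic : Set where
  field
    nVals    : ℕ
    𝐭 𝐟      : Fin nVals
    Des      : Subset nVals
    𝐭-des    : 𝐭 ∈ Des
    𝐟-nondes : 𝐟 ∉ Des
    nConn    : ℕ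
    arity    : Fin nConn → ℕ
    fn       : (c : Fin nConn) → Vec (Fin nVals) (arity c) → Fin nVals

module _ (L : Logic) where
  open Logic L

  Val : Set
  Val = Fin nVals

  -- Propositional constants are indexed by ℕ (a fixed countably infinite set C).
  data Formula : Set where
    pc  : ℕ → Formula
    app : (c : Fin nConn) → Vec Formula (arity c) → Formula

  Theory : Set₁
  Theory = Formula → Set

  ConstSet : Set₁
  ConstSet = ℕ → Set

  Interp : Set
  Interp = ℕ → Val

  mutual
    val : Interp → Formula → Val
    val I (pc p)     = I p
    val I (app c φs) = fn c (vals I φs)

    vals : ∀ {m} → Interp → Vec Formula m → Vec Val m
    vals I []       = []
    vals I (φ ∷ φs) = val I φ ∷ vals I φs

  data Occurs (p : ℕ) : Formula → Set where
    here : Occurs p (pc p)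
    sub  : ∀ {c φs} → Any (Occurs p) φs → Occurs p (app c φs)

  IsModel : Interp → Formula → Set
  IsModel I φ = val I φ ∈ Des

  IsModelTh : Interp → Theory → Set
  IsModelTh I Γ = ∀ φ → Γ φ → IsModel I φ

  Leq : Subset nVals → ConstSet → Interp → Interp → Set
  Leq 𝓘 Θ I J = ∀ p → Θ p → I p ∈ 𝓘 → J p ∈ 𝓘

  Lt : Subset nVals → ConstSet → Interp → Interp → Set
  Lt 𝓘 Θ I J = Leq 𝓘 Θ I J × ¬ Leq 𝓘 Θ J I

  MinimalModelOn : Subset nVals → ConstSet → Theory → Interp → Set
  MinimalModelOn 𝓘 Θ Γ I = IsModelTh I Γ × (∀ J → IsModelTh J Γ → ¬ Lt 𝓘 Θ J I)

  AllC : ConstSet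
  AllC _ = ⊤

  EmptyC : ConstSet
  EmptyC _ = ⊥

  _∪C_ : ConstSet → ConstSet → ConstSet
  (Θ ∪C Σ') p = Θ p ⊎ Σ' p

  MinimalModel : Subset nVals → Theory → Interp → Set
  MinimalModel 𝓘 Γ I = MinimalModelOn 𝓘 AllC Γ I

  Entails : Subset nVals → Theory → Theory → Set
  Entails 𝓘 Γ Δ = ∀ I → MinimalModel 𝓘 Γ I → ∃[ φ ] (Δ φ × IsModel I φ)

  record Sequent : Set₁ where
    constructor ⟨_︔_⇒_︔_⟩
    field
      sΣ : ConstSet
      sΓ : Theory
      sΔ : Theory
      sΘ : ConstSet

  SequentTrue : Subset nVals → Sequent → Set
  SequentTrue 𝓘 ⟨ Σ' ︔ Γ ⇒ Δ ︔ Θ ⟩ =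
    ∀ I → MinimalModelOn 𝓘 (Θ ∪C Σ') Γ I → (∀ p → Σ' p → I p ∈ 𝓘) →
    ∃[ φ ] (Δ φ × IsModel I φ)

  Var : Theory → Theory → ConstSet
  Var Γ Δ p = ∃[ φ ] ((Γ φ ⊎ Δ φ) × Occurs p φ)

-- classical metatheory (the paper reasons classically)
ExcludedMiddle : Set₁
ExcludedMiddle = (P : Set) → Dec P

-- An interpretation matters to Γ and Δ only on Var(Γ ∪ Δ). Patching a model of Γ
-- off Var(Γ ∪ Δ) with another interpretation yields a model of Γ again, so
-- comparisons under ≤^{𝓘,Var(Γ ∪ Δ)} lift to comparisons under ≤^{𝓘,C}: patch
-- with the model being compared against for one direction, and for the other
-- with a value outside 𝓘 (when one exists), which is the least possible choice.
module Submission where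

open import Defs
open import Data.Fin.Subset using (Subset; _∈_)
open import Data.Fin.Subset.Properties using (_∈?_)
open import Data.Fin.Properties using (any?)
open import Data.Vec using (Vec; []; _∷_)
open import Data.Vec.Relation.Unary.Any using (Any; here; there)
open import Data.Product using (_,_)
open import Data.Sum using (inj₁; inj₂)
open import Data.Unit using (tt)
open import Data.Empty using (⊥-elim)
open import Function.Bundles using (_⇔_; mk⇔)
open import Relation.Nullary using (¬_; Dec; yes; no)
open import Relation.Nullary.Decidable using (decidable-stable; ¬?)
open import Relation.Binary.PropositionalEquality using (_≡_; refl; sym; cong; cong₂; subst)

module _ (L : Logic) where
  open Logic L

  mutual
    val-cong : ∀ {I J : Interp L} φ → (∀ p → Occurs L p φ → I p ≡ J p) →
               val L I φ ≡ val L J φ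
    val-cong (pc p)     I≡J = I≡J p here
    val-cong (app c φs) I≡J = cong (fn c) (vals-cong φs (λ p o → I≡J p (sub o)))

    vals-cong : ∀ {I J : Interp L} {m} (φs : Vec (Formula L) m) →
                (∀ p → Any (Occurs L p) φs → I p ≡ J p) → vals L I φs ≡ vals L J φs
    vals-cong []       _   = refl
    vals-cong (φ ∷ φs) I≡J = cong₂ _∷_ (val-cong φ (λ p o → I≡J p (here o)))
                                       (vals-cong φs (λ p o → I≡J p (there o)))

  IsModel-cong : ∀ {I J : Interp L} φ → (∀ p → Occurs L p φ → I p ≡ J p) →
                 IsModel L I φ → IsModel L J φ
  IsModel-cong φ I≡J = subst (_∈ Des) (val-cong φ I≡J)

  _Covers_ : ConstSet L → Theory L → Set
  Θ Covers Γ = ∀ {φ p} → Γ φ → Occurs L p φ → Θ p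

  module _ (𝓘 : Subset nVals) where

    outside : Val L
    outside with any? (λ v → ¬? (v ∈? 𝓘))
    ... | yes (v , _) = v
    ... | no _        = 𝐭

    outside∈⇒all∈ : outside ∈ 𝓘 → ∀ v → v ∈ 𝓘
    outside∈⇒all∈ with any? (λ v → ¬? (v ∈? 𝓘))
    ... | yes (_ , w∉) = λ w∈ → ⊥-elim (w∉ w∈)
    ... | no  none     = λ _ v → decidable-stable (v ∈? 𝓘) (λ v∉ → none (v , v∉))

  module _ (em : ExcludedMiddle) (Θ : ConstSet L) where

    patch : Interp L → Interp L → Interp L
    patch J K p with em (Θ p)
    ... | yes _ = J p
    ... | no  _ = K p

    patch-on : ∀ J K p → Θ p → patch J K p ≡ J p
    patch-on J K p p∈ with em (Θ p)
    ... | yes _  = refl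
    ... | no  p∉ = ⊥-elim (p∉ p∈)

    patch-off : ∀ J K p → ¬ Θ p → patch J K p ≡ K p
    patch-off J K p p∉ with em (Θ p)
    ... | yes p∈ = ⊥-elim (p∉ p∈)
    ... | no  _  = refl

    IsModelTh-patch : ∀ {Γ J K} → Θ Covers Γ → IsModelTh L J Γ → IsModelTh L (patch J K) Γ
    IsModelTh-patch {J = J} {K} Θ⊇Γ J⊨Γ φ γ =
      IsModel-cong φ (λ p o → sym (patch-on J K p (Θ⊇Γ γ o))) (J⊨Γ φ γ)

    module _ (𝓘 : Subset nVals) where

      Leq-patch⇒Leq : ∀ {I J K} → Leq L 𝓘 (AllC L) I (patch J K) → Leq L 𝓘 Θ I J
      Leq-patch⇒Leq {I} {J} {K} I≤JK p p∈ Ip∈ = subst (_∈ 𝓘) (patch-on J K p p∈) (I≤JK p tt Ip∈)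

      Leq⇒patch-Leq : ∀ {I J K} → Leq L 𝓘 Θ J I → (∀ p → ¬ Θ p → K p ∈ 𝓘 → I p ∈ 𝓘) →
                      Leq L 𝓘 (AllC L) (patch J K) I
      Leq⇒patch-Leq {I} {J} {K} J≤I K≤I p _ JKp∈ = by-cases (em (Θ p))
        where
        by-cases : Dec (Θ p) → I p ∈ 𝓘
        by-cases (yes p∈) = J≤I p p∈ (subst (_∈ 𝓘) (patch-on J K p p∈) JKp∈)
        by-cases (no  p∉) = K≤I p p∉ (subst (_∈ 𝓘) (patch-off J K p p∉) JKp∈)

      minimal⇒minimalOn : ∀ {Γ I} → Θ Covers Γ →
                          MinimalModel L 𝓘 Γ I → MinimalModelOn L 𝓘 Θ Γ I
      minimal⇒minimalOn {Γ} {I} Θ⊇Γ (I⊨Γ , I-min) = I⊨Γ , I-minOn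
        where
        I-minOn : ∀ J → IsModelTh L J Γ → ¬ Lt L 𝓘 Θ J I
        I-minOn J J⊨Γ (J≤I , I≰J) =
          I-min (patch J I) (IsModelTh-patch Θ⊇Γ J⊨Γ)
                (Leq⇒patch-Leq J≤I (λ _ _ Ip∈ → Ip∈) , λ I≤JI → I≰J (Leq-patch⇒Leq I≤JI))

      minimalOn⇒minimal-patch : ∀ {Γ I} → Θ Covers Γ →
                                MinimalModelOn L 𝓘 Θ Γ I →
                                MinimalModel L 𝓘 Γ (patch I (λ _ → outside 𝓘))
      minimalOn⇒minimal-patch {Γ} {I} Θ⊇Γ (I⊨Γ , I-minOn) = IsModelTh-patch Θ⊇Γ I⊨Γ , I'-min
        where
        I'-min : ∀ J → IsModelTh L J Γ → ¬ Lt L 𝓘 (AllC L) J (patch I (λ _ → outside 𝓘))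
        I'-min J J⊨Γ (J≤I' , I'≰J) =
          I-minOn J J⊨Γ (Leq-patch⇒Leq J≤I' ,
                         λ I≤J → I'≰J (Leq⇒patch-Leq I≤J (λ p _ o∈ → outside∈⇒all∈ 𝓘 o∈ (J p))))

mainTheorem1 : ExcludedMiddle →
    (L : Logic) (𝓘 : Subset (Logic.nVals L)) (Γ Δ : Theory L) →
    Entails L 𝓘 Γ Δ ⇔ SequentTrue L 𝓘 ⟨ EmptyC L ︔ Γ ⇒ Δ ︔ Var L Γ Δ ⟩
mainTheorem1 em L 𝓘 Γ Δ = mk⇔ sequent-true entails
  where
  Θ : ConstSet L
  Θ = _∪C_ L (Var L Γ Δ) (EmptyC L)

  Θ⊇Γ : _Covers_ L Θ Γ
  Θ⊇Γ {φ} γ o = inj₁ (φ , inj₁ γ , o)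

  Θ⊇Δ : _Covers_ L Θ Δ
  Θ⊇Δ {φ} δ o = inj₁ (φ , inj₂ δ , o)

  sequent-true : Entails L 𝓘 Γ Δ → SequentTrue L 𝓘 ⟨ EmptyC L ︔ Γ ⇒ Δ ︔ Var L Γ Δ ⟩
  sequent-true Γ⊨Δ I I-minOn _
    with Γ⊨Δ _ (minimalOn⇒minimal-patch L em Θ 𝓘 Θ⊇Γ I-minOn)
  ... | φ , δ , I'⊨φ = φ , δ , IsModel-cong L φ (λ p o → patch-on L em Θ I _ p (Θ⊇Δ δ o)) I'⊨φ

  entails : SequentTrue L 𝓘 ⟨ EmptyC L ︔ Γ ⇒ Δ ︔ Var L Γ Δ ⟩ → Entails L 𝓘 Γ Δ
  entails seq I I-min = seq I (minimal⇒minimalOn L em Θ 𝓘 Θ⊇Γ I-min) (λ _ ())
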